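{- For any bounded graph $\mathfrak{F}=\langle W,R\rangle$, any set $I$ and any ultrafilter $D$ over $I$, we have $\Lambda(\mathfrak{F})=\Lambda(\mathfrak{F}^{\mathfrak{ue}})=\Lambda({}^I\mathfrak{F}/D)$.
   Context: A directed graph is bounded if there is $m\in\omega$ such that every vertex $w$ satisfies $|\{s:Rws\}|+|\{s:Rsw\}|\leq m$. The ultrafilter extension is $\mathfrak{F}^{\mathfrak{ue}}=\langle\mathrm{Uf}(W),R^{\mathfrak{ue}}\rangle$, with $\mathrm{Uf}(W)$ the set of ultrafilters over $W$ and $R^{\mathfrak{ue}}uv$ iff $\{w:\exists s\,(Rws\wedge s\in X)\}\in u$ for every $X\in v$. ${}^I\mathfrak{F}/D$ is the ultrapower. For a frame (directed graph) $\mathfrak{G}$, $\Lambda(\mathfrak{G})$ is the set of formulas of the basic propositional modal language (propositional variables, Boolean connectives and one unary modality $\diamondsuit$, interpreted by $w\Vdash\diamondsuit\varphi$ iff some $R$-successor of $w$ satisfies $\varphi$) that are true at every point of $\mathfrak{G}$ under every valuation. -}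

module Defs where

open import Level using (Level; 0ℓ; _⊔_) renaming (suc to lsuc)
open import Data.Nat using (ℕ; _+_; _≤_)
open import Data.Product using (Σ; ∃; _×_; _,_)
open import Data.Sum using (_⊎_)
open import Data.Unit using (⊤)
open import Data.Empty using (⊥)
open import Data.List using (List; length)
open import Data.List.Membership.Propositional using (_∈_)
open import Data.List.Relation.Unary.Unique.Propositional using (Unique)
open import Relation.Nullary using (¬_)
open import Relation.Binary.PropositionalEquality using (_≡_)
open import Function.Bundles using (_⇔_)

HasSize : {W : Set} → (W → Set) → ℕ → Set
HasSize {W} P n = Σ (List W) λ xs →
  Unique xs × (∀ x → P x → x ∈ xs) × (∀ x → x ∈ xs → P x) × length xs ≡ n

record Graph : Set₁ where
  field
    W : Set
    R : W → W → Set

Bounded : Graph → Set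
Bounded G = Σ ℕ λ m → ∀ w →
  Σ ℕ λ k → Σ ℕ λ l →
    HasSize (λ s → R w s) k × HasSize (λ s → R s w) l × (k + l ≤ m)
  where open Graph G

record Ultrafilter (X : Set) : Set₁ where
  field
    mem     : (X → Set) → Set
    top     : mem (λ _ → ⊤)
    proper  : ¬ mem (λ _ → ⊥)
    upward  : ∀ A B → (∀ x → A x → B x) → mem A → mem B
    inter   : ∀ A B → mem A → mem B → mem (λ x → A x × B x)
    ultra   : ∀ A → mem A ⊎ mem (λ x → ¬ A x)
open Ultrafilter public

-- Frames whose carrier is a quotient, presented as a setoid:
-- points are ≈-classes; R and valuations are required/checked to respect ≈.

record QFrame (a : Level) : Set (lsuc a) where
  field
    Carrier : Set a
    _≈_     : Carrier → Carrier → Set a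
    Rel     : Carrier → Carrier → Set a

frame : Graph → QFrame 0ℓ
frame G = record { Carrier = W ; _≈_ = _≡_ ; Rel = R }
  where open Graph G

ueFrame : Graph → QFrame (lsuc 0ℓ)
ueFrame G = record
  { Carrier = Ultrafilter W
  ; _≈_ = λ u v → ∀ A → (mem u A ⇔ mem v A)
  ; Rel = λ u v → ∀ X → mem v X → mem u (λ w → Σ W λ s → R w s × X s)
  }
  where open Graph G

ultrapower : Graph → (I : Set) → Ultrafilter I → QFrame 0ℓ
ultrapower G I D = record
  { Carrier = I → W
  ; _≈_ = λ f g → mem D (λ i → f i ≡ g i)
  ; Rel = λ f g → mem D (λ i → R (f i) (g i))
  }
  where open Graph G

data Fm : Set where
  var  : ℕ → Fm
  fal  : Fm
  neg  : Fm → Fm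
  _∧'_ : Fm → Fm → Fm
  _∨'_ : Fm → Fm → Fm
  _⇒'_ : Fm → Fm → Fm
  ◇    : Fm → Fm

record Valuation {a : Level} (F : QFrame a) : Set (lsuc a) where
  open QFrame F
  field
    V    : ℕ → Carrier → Set a
    resp : ∀ n x y → x ≈ y → V n x → V n y

Forces : {a : Level} (F : QFrame a) → Valuation F → QFrame.Carrier F → Fm → Set a
Forces F M w (var n)   = Valuation.V M n w
Forces F M w fal       = Level.Lift _ ⊥
Forces F M w (neg φ)   = ¬ Forces F M w φ
Forces F M w (φ ∧' ψ)  = Forces F M w φ × Forces F M w ψ
Forces F M w (φ ∨' ψ)  = Forces F M w φ ⊎ Forces F M w ψ
Forces F M w (φ ⇒' ψ)  = Forces F M w φ → Forces F M w ψ
Forces F M w (◇ φ)     = Σ (QFrame.Carrier F) λ s → QFrame.Rel F w s × Forces F M s φ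

Λ : {a : Level} → QFrame a → Fm → Set (lsuc a)
Λ F φ = ∀ (M : Valuation F) (w : QFrame.Carrier F) → Forces F M w φ

SameLogic : {a b : Level} → QFrame a → QFrame b → Set (lsuc (a ⊔ b))
SameLogic F G = ∀ φ → (Λ F φ ⇔ Λ G φ)

-- Graded bisimulations preserve formulas of modal depth ≤ n, so it suffices to match models on
-- 𝔉 with models on the large frame up to every finite depth, in both directions.  𝔉 sits inside
-- 𝔉^ue (principal ultrafilters) and inside ^I𝔉/D (constant functions) in such a way that every
-- successor of an embedded point is again embedded; transporting valuations along the embedding
-- gives Λ(large) ⊆ Λ(𝔉).  Conversely, a degree bound m lets every successor be named by one of
-- m indices, so the points n steps away are reached along words of length ≤ n.  A point y of the
-- large frame is the limit of the points of W along an ultrafilter u, and the points reachable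
-- from y are the u-limits of the walks along words.  As there are only finitely many words of
-- length ≤ n, some w₀ ∈ W agrees with u on which of these walks meet, and pulling the valuation
-- back along the walks from w₀ gives a model n-bisimilar to y: Λ(𝔉) ⊆ Λ(large).

module Submission where

open import Defs
open import Level using (Level; 0ℓ; Lift; lift; lower) renaming (suc to lsuc; _⊔_ to _⊔ℓ_)
open import Data.Nat using (ℕ; zero; suc; _+_; _⊔_; _≤_; s≤s)
open import Data.Nat.Properties using (≤-refl; ≤-trans; m≤m+n; m⊔n≤o⇒m≤o; m⊔n≤o⇒n≤o; +-suc)
open import Data.Product using (Σ; _×_; _,_; proj₁; proj₂)
open import Data.Product.Function.NonDependent.Propositional using (_×-⇔_)
open import Data.Sum using (_⊎_; inj₁; inj₂)
open import Data.Sum.Function.Propositional using (_⊎-⇔_)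
open import Data.Empty using (⊥-elim)
open import Data.Unit using (tt)
open import Data.Fin as Fin using (Fin; toℕ)
open import Data.Fin.Properties using (toℕ-inject≤)
open import Data.Maybe using (Maybe; just; nothing; _>>=_; fromMaybe)
open import Data.Maybe.Properties using (just-injective)
open import Data.List using (List; []; _∷_; length; allFin; cartesianProductWith; cartesianProduct)
open import Data.List.Membership.Propositional using (_∈_)
open import Data.List.Membership.Propositional.Properties
  using (∈-allFin; ∈-cartesianProductWith⁺; ∈-cartesianProduct⁺)
open import Data.List.Relation.Unary.Any using (here; there)
open import Data.List.Relation.Unary.All as All using (All; []; _∷_)
open import Relation.Nullary using (¬_; yes; no)
open import Axiom.ExcludedMiddle using (ExcludedMiddle)
open import Relation.Nullary.Decidable using (True; toWitness; fromWitness; map′; toSum)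
open import Axiom.DoubleNegationElimination using (DoubleNegationElimination; em⇒dne)
open import Relation.Binary.PropositionalEquality using (_≡_; refl; sym; trans; subst; subst₂)
open import Relation.Binary.Structures using (IsEquivalence)
open import Function.Bundles using (_⇔_; mk⇔; Equivalence)
open import Function.Properties.Equivalence using (⇔-isEquivalence)
open import Function.Related.TypeIsomorphisms using (→-cong-⇔; ¬-cong-⇔)

open Equivalence using (to; from)

depth : Fm → ℕ
depth (var _)  = 0
depth fal      = 0
depth (neg φ)  = depth φ
depth (φ ∧' ψ) = depth φ ⊔ depth ψ
depth (φ ∨' ψ) = depth φ ⊔ depth ψ
depth (φ ⇒' ψ) = depth φ ⊔ depth ψ
depth (◇ φ)    = suc (depth φ)

module _ {a b : Level} {F : QFrame a} {H : QFrame b} where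
  open QFrame F renaming (Carrier to X; Rel to R)
  open QFrame H renaming (Carrier to Y; Rel to S)
  open Valuation

  record GradedBisimulation (M : Valuation F) (N : Valuation H) : Set (lsuc (a ⊔ℓ b)) where
    field
      Z     : ℕ → X → Y → Set (a ⊔ℓ b)
      atom  : ∀ {n x y} p → Z n x y → V M p x ⇔ V N p y
      forth : ∀ {n x y x′} → Z (suc n) x y → R x x′ → Σ Y λ y′ → S y y′ × Z n x′ y′
      back  : ∀ {n x y y′} → Z (suc n) x y → S y y′ → Σ X λ x′ → R x x′ × Z n x′ y′

  module _ {M : Valuation F} {N : Valuation H} (B : GradedBisimulation M N) where
    open GradedBisimulation B

    bisimilar⇒⇔ : ∀ φ {n x y} → depth φ ≤ n → Z n x y → Forces F M x φ ⇔ Forces H N y φ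
    bisimilar⇒⇔ (var p)  d z = atom p z
    bisimilar⇒⇔ fal      d z = mk⇔ (λ ()) (λ ())
    bisimilar⇒⇔ (neg φ)  d z = ¬-cong-⇔ (bisimilar⇒⇔ φ d z)
    bisimilar⇒⇔ (φ ∧' ψ) d z = bisimilar⇒⇔ φ (m⊔n≤o⇒m≤o _ _ d) z ×-⇔ bisimilar⇒⇔ ψ (m⊔n≤o⇒n≤o _ _ d) z
    bisimilar⇒⇔ (φ ∨' ψ) d z = bisimilar⇒⇔ φ (m⊔n≤o⇒m≤o _ _ d) z ⊎-⇔ bisimilar⇒⇔ ψ (m⊔n≤o⇒n≤o _ _ d) z
    bisimilar⇒⇔ (φ ⇒' ψ) d z = →-cong-⇔ (bisimilar⇒⇔ φ (m⊔n≤o⇒m≤o _ _ d) z) (bisimilar⇒⇔ ψ (m⊔n≤o⇒n≤o _ _ d) z)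
    bisimilar⇒⇔ (◇ φ) (s≤s d) z = mk⇔
      (λ (x′ , r , fx′) → let y′ , s , z′ = forth z r in y′ , s , to (bisimilar⇒⇔ φ d z′) fx′)
      (λ (y′ , s , fy′) → let x′ , r , z′ = back z s in x′ , r , from (bisimilar⇒⇔ φ d z′) fy′)

  Approximable : Set (lsuc (a ⊔ℓ b))
  Approximable = ∀ n (M : Valuation F) x →
    Σ (Valuation H) λ N → Σ Y λ y → Σ (GradedBisimulation M N) λ B → GradedBisimulation.Z B n x y

  approximable⇒Λ⊇ : Approximable → ∀ φ → Λ H φ → Λ F φ
  approximable⇒Λ⊇ approx φ valid M x =
    let N , y , B , z = approx (depth φ) M x
    in from (bisimilar⇒⇔ B φ ≤-refl z) (valid N y)

record IsSetoidFrame {a : Level} (H : QFrame a) : Set a where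
  open QFrame H
  field
    isEquivalence : IsEquivalence _≈_
    Rel-respˡ     : ∀ {x y t} → x ≈ y → Rel x t → Rel y t
  open IsEquivalence isEquivalence public
    renaming (refl to ≈-refl; sym to ≈-sym; trans to ≈-trans)

module _ {a : Level} (G : Graph) (H : QFrame a) where
  open Graph G
  open QFrame H

  record ModalEmbedding : Set (lsuc a) where
    field
      embed      : W → Carrier
      embed-Rel  : ∀ {x s} → R x s → Rel (embed x) (embed s)
      embed-back : ∀ {x t} → Rel (embed x) t → Σ W λ s → R x s × t ≈ embed s
      lift-val   : Valuation (frame G) → Valuation H
      lift-embed : ∀ M p x → Valuation.V (lift-val M) p (embed x) ⇔ Valuation.V M p x

  embedding⇒approximable : IsSetoidFrame H → ModalEmbedding → Approximable {F = frame G} {H = H}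
  embedding⇒approximable laws e n M x = lift-val M , embed x , bisim , ≈-refl
    where
    open IsSetoidFrame laws
    open ModalEmbedding e
    bisim : GradedBisimulation M (lift-val M)
    bisim = record
      { Z     = λ _ x y → y ≈ embed x
      ; atom  = λ p y≈x → mk⇔ (λ v → Valuation.resp (lift-val M) p _ _ (≈-sym y≈x) (from (lift-embed M p _) v))
                              (λ v → to (lift-embed M p _) (Valuation.resp (lift-val M) p _ _ y≈x v))
      ; forth = λ y≈x r → embed _ , Rel-respˡ (≈-sym y≈x) (embed-Rel r) , ≈-refl
      ; back  = λ y≈x r → embed-back (Rel-respˡ y≈x r)
      }

lowerExcludedMiddle : ∀ {a b} → ExcludedMiddle (a ⊔ℓ b) → ExcludedMiddle a
lowerExcludedMiddle {b = b} em = map′ lower lift (em {Lift b _})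

module _ {B : Set} (U : Ultrafilter B) where

  ∅∉ : (A : B → Set) → (∀ b → ¬ A b) → ¬ mem U A
  ∅∉ A empty m = proper U (upward U A _ empty m)

  disjoint∉ : {A : B → Set} → mem U A → ¬ mem U (λ b → ¬ A b)
  disjoint∉ m m¬ = ∅∉ _ (λ b (a , ¬a) → ¬a a) (inter U _ _ m m¬)

  ∉⇒∁∈ : {A : B → Set} → ¬ mem U A → mem U (λ b → ¬ A b)
  ∉⇒∁∈ {A} ∉ with ultra U A
  ... | inj₁ m  = ⊥-elim (∉ m)
  ... | inj₂ m¬ = m¬

  mem-∀Fin : {m : ℕ} (P : Fin m → B → Set) → (∀ j → mem U (P j)) → mem U (λ b → ∀ j → P j b)
  mem-∀Fin {zero}  P ms = upward U _ _ (λ _ _ ()) (top U)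
  mem-∀Fin {suc m} P ms = upward U _ _ (λ { b (p₀ , ps) Fin.zero → p₀ ; b (p₀ , ps) (Fin.suc j) → ps j })
    (inter U _ _ (ms Fin.zero) (mem-∀Fin (λ j → P (Fin.suc j)) (λ j → ms (Fin.suc j))))

  mem-All : {K : Set} (P : K → B → Set) (ks : List K) →
    All (λ k → mem U (P k)) ks → mem U (λ b → All (λ k → P k b) ks)
  mem-All P []       []         = upward U _ _ (λ _ _ → []) (top U)
  mem-All P (k ∷ ks) (m ∷ ms) = upward U _ _ (λ b (p , ps) → p ∷ ps) (inter U _ _ m (mem-All P ks ms))

  mem-agree : (A : B → Set) → mem U (λ b → A b ⇔ mem U A)
  mem-agree A with ultra U A
  ... | inj₁ m  = upward U _ _ (λ b a → mk⇔ (λ _ → m) (λ _ → a)) m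
  ... | inj₂ m¬ = upward U _ _ (λ b ¬a → mk⇔ (λ a → ⊥-elim (¬a a)) (λ m → ⊥-elim (disjoint∉ m m¬))) m¬

  ⊆⇒≈ : (U′ : Ultrafilter B) → (∀ A → mem U A → mem U′ A) → ∀ A → mem U A ⇔ mem U′ A
  ⊆⇒≈ U′ U⊆U′ A = mk⇔ (U⊆U′ A) reflect
    where
    reflect : mem U′ A → mem U A
    reflect m′ with ultra U A
    ... | inj₁ m  = m
    ... | inj₂ m¬ = ⊥-elim (proper U′ (upward U′ _ _ (λ b (a , ¬a) → ¬a a) (inter U′ _ _ m′ (U⊆U′ _ m¬))))

  module _ (dne : DoubleNegationElimination 0ℓ) where

    witness : {A : B → Set} → mem U A → Σ B A
    witness {A} m = dne λ ∄ → ∅∉ A (λ b a → ∄ (b , a)) m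

    mem-const : (P : Set) → mem U (λ _ → P) ⇔ P
    mem-const P = mk⇔ (λ m → proj₂ (witness m)) (λ p → upward U _ _ (λ _ _ → p) (top U))

    prime-Fin : {m : ℕ} (P : Fin m → B → Set) →
      mem U (λ b → Σ (Fin m) λ j → P j b) → Σ (Fin m) λ j → mem U (P j)
    prime-Fin P m = dne λ ∄ → ∅∉ _ (λ b ((j , p) , ¬ps) → ¬ps j p)
      (inter U _ _ m (mem-∀Fin (λ j b → ¬ P j b) (λ j → ∉⇒∁∈ (λ mj → ∄ (j , mj)))))

    typical-point : {K : Set} (P : K → B → Set) (ks : List K) →
      Σ B λ b → All (λ k → P k b ⇔ mem U (P k)) ks
    typical-point P ks = witness (mem-All _ ks (All.tabulate (λ {k} _ → mem-agree (P k))))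

image : {B C : Set} → Ultrafilter B → (B → C) → Ultrafilter C
image U g = record
  { mem    = λ A → mem U (λ b → A (g b))
  ; top    = top U
  ; proper = proper U
  ; upward = λ A A′ A⊆A′ → upward U _ _ (λ b → A⊆A′ (g b))
  ; inter  = λ A A′ → inter U _ _
  ; ultra  = λ A → ultra U _
  }

partialImage : {B C : Set} (U : Ultrafilter B) (g : B → Maybe C) →
  mem U (λ b → Σ C λ c → g b ≡ just c) → Ultrafilter C
partialImage {B} {C} U g dom = record
  { mem    = λ A → mem U (λ b → Σ C λ c → g b ≡ just c × A c)
  ; top    = upward U _ _ (λ b (c , e) → c , e , tt) dom
  ; proper = λ m → proper U (upward U _ _ (λ { b (c , e , ()) }) m)
  ; upward = λ A A′ A⊆A′ → upward U _ _ (λ b (c , e , a) → c , e , A⊆A′ c a)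
  ; inter  = λ A A′ m m′ → upward U _ _
      (λ { b ((c , e , a) , (c′ , e′ , a′)) → c , e , a , subst A′ (just-injective (trans (sym e′) e)) a′ })
      (inter U _ _ m m′)
  ; ultra  = ultra′
  }
  where
  ultra′ : ∀ A → mem U (λ b → Σ C λ c → g b ≡ just c × A c) ⊎ mem U (λ b → Σ C λ c → g b ≡ just c × ¬ A c)
  ultra′ A with ultra U (λ b → Σ C λ c → g b ≡ just c × A c)
  ... | inj₁ m  = inj₁ m
  ... | inj₂ m¬ = inj₂ (upward U _ _ (λ b (∉A , (c , e)) → c , e , λ a → ∉A (c , e , a)) (inter U _ _ m¬ dom))

_!?_ : {A : Set} → List A → ℕ → Maybe A
[]       !? _     = nothing
(x ∷ xs) !? zero  = just x
(x ∷ xs) !? suc n = xs !? n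

!?⇒∈ : {A : Set} (xs : List A) (n : ℕ) {s : A} → xs !? n ≡ just s → s ∈ xs
!?⇒∈ (x ∷ xs) zero    refl = here refl
!?⇒∈ (x ∷ xs) (suc n) e    = there (!?⇒∈ xs n e)

∈⇒!? : {A : Set} {xs : List A} {s : A} → s ∈ xs → Σ (Fin (length xs)) λ i → xs !? toℕ i ≡ just s
∈⇒!? (here refl) = Fin.zero , refl
∈⇒!? (there s∈)  = let i , e = ∈⇒!? s∈ in Fin.suc i , e

module _ (G : Graph) where
  open Graph G

  record Branching (m : ℕ) : Set where
    field
      step          : Fin m → W → Maybe W
      step-sound    : ∀ {j w s} → step j w ≡ just s → R w s
      step-complete : ∀ {w s} → R w s → Σ (Fin m) λ j → step j w ≡ just s

  successor-list : (bd : Bounded G) (w : W) → Σ (List W) λ xs →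
    (∀ s → R w s → s ∈ xs) × (∀ s → s ∈ xs → R w s) × length xs ≤ proj₁ bd
  successor-list (m , bound) w with bound w
  ... | k , l , (xs , _ , complete , sound , refl) , _ , k+l≤m =
    xs , complete , sound , ≤-trans (m≤m+n k l) k+l≤m

  bounded⇒branching : (bd : Bounded G) → Branching (proj₁ bd)
  bounded⇒branching bd = record
    { step          = λ j w → proj₁ (successor-list bd w) !? toℕ j
    ; step-sound    = λ {j} {w} e → let xs , _ , xs⊆R , _ = successor-list bd w in xs⊆R _ (!?⇒∈ xs (toℕ j) e)
    ; step-complete = complete
    }
    where
    complete : ∀ {w s} → R w s → Σ (Fin (proj₁ bd)) λ j → proj₁ (successor-list bd w) !? toℕ j ≡ just s
    complete {w} {s} r =
      let xs , R⊆xs , _ , len≤m = successor-list bd w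
          i , e = ∈⇒!? (R⊆xs s r)
      in Fin.inject≤ i len≤m , subst (λ k → xs !? k ≡ just s) (sym (toℕ-inject≤ i len≤m)) e

  module Walks {m : ℕ} (br : Branching m) where
    open Branching br

    Word : Set
    Word = List (Fin m)

    walk : Word → W → Maybe W
    walk []      w = just w
    walk (j ∷ τ) w = walk τ w >>= step j

    walk-∷⁺ : ∀ j τ {w v s} → walk τ w ≡ just v → step j v ≡ just s → walk (j ∷ τ) w ≡ just s
    walk-∷⁺ j τ e e′ rewrite e = e′

    walk-∷⁻ : ∀ j τ {w s} → walk (j ∷ τ) w ≡ just s → Σ W λ v → walk τ w ≡ just v × step j v ≡ just s
    walk-∷⁻ j τ {w} e with walk τ w
    ... | just v = v , refl , e

    words≤ : ℕ → List Word
    words≤ zero    = [] ∷ []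
    words≤ (suc n) = [] ∷ cartesianProductWith _∷_ (allFin m) (words≤ n)

    ∈-words≤ : ∀ n τ → length τ ≤ n → τ ∈ words≤ n
    ∈-words≤ zero    []      _       = here refl
    ∈-words≤ (suc n) []      _       = here refl
    ∈-words≤ (suc n) (j ∷ τ) (s≤s l) = there (∈-cartesianProductWith⁺ _∷_ (∈-allFin j) (∈-words≤ n τ l))

    Meet : Word → Word → W → Set
    Meet τ τ′ w = Σ W λ s → walk τ w ≡ just s × walk τ′ w ≡ just s

    Defined : Word → W → Set
    Defined τ = Meet τ τ

    module _ {a : Level} (H : QFrame a) where
      open QFrame H

      -- Reading y as the limit of the points of W along u, pt τ is the limit of the walks along τ.
      record Presentation (y : Carrier) : Set (lsuc a) where
        field
          u       : Ultrafilter W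
          pt      : ∀ τ → mem u (Defined τ) → Carrier
          pt-[]   : ∀ d → y ≈ pt [] d
          pt-Rel  : ∀ τ j d d′ → Rel (pt τ d) (pt (j ∷ τ) d′)
          pt-back : ∀ τ d {t} → Rel (pt τ d) t →
                    Σ (Fin m) λ j → Σ (mem u (Defined (j ∷ τ))) λ d′ → t ≈ pt (j ∷ τ) d′
          pt-cong : ∀ τ τ′ d d′ → mem u (Meet τ τ′) → pt τ d ≈ pt τ′ d′

      module Approximant (dne : DoubleNegationElimination 0ℓ) (em : ExcludedMiddle a) (laws : IsSetoidFrame H)
                         {y : Carrier} (P : Presentation y) (n : ℕ) (N : Valuation H) where
        open IsSetoidFrame laws
        open Presentation P

        typical : Σ W λ w →
          All (λ (τ , τ′) → Meet τ τ′ w ⇔ mem u (Meet τ τ′)) (cartesianProduct (words≤ n) (words≤ n))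
        typical = typical-point u dne _ _

        w₀ : W
        w₀ = proj₁ typical

        meet⇔ : ∀ τ τ′ → length τ ≤ n → length τ′ ≤ n → Meet τ τ′ w₀ ⇔ mem u (Meet τ τ′)
        meet⇔ τ τ′ l l′ = All.lookup (proj₂ typical) (∈-cartesianProduct⁺ (∈-words≤ n τ l) (∈-words≤ n τ′ l′))

        defined⇔ : ∀ τ → length τ ≤ n → Defined τ w₀ ⇔ mem u (Defined τ)
        defined⇔ τ l = meet⇔ τ τ l l

        d[] : mem u (Defined [])
        d[] = upward u _ _ (λ w _ → w , refl , refl) (top u)

        Reach : ℕ → Carrier → W → Set a
        Reach k z x = Σ Word λ τ → length τ + k ≤ n × walk τ w₀ ≡ just x ×
          Σ (mem u (Defined τ)) λ d → z ≈ pt τ d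

        shift : ∀ {k} (τ : Word) (j : Fin m) → length τ + suc k ≤ n → length (j ∷ τ) + k ≤ n
        shift {k} τ j = subst (_≤ n) (+-suc (length τ) k)

        short : ∀ {k} (τ : Word) → length τ + k ≤ n → length τ ≤ n
        short {k} τ = ≤-trans (m≤m+n (length τ) k)

        Labelled : ℕ → W → Set a
        Labelled p x = Σ Word λ τ → length τ ≤ n × walk τ w₀ ≡ just x ×
          Σ (mem u (Defined τ)) λ d → Valuation.V N p (pt τ d)

        M : Valuation (frame G)
        M = record { V = λ p x → True (em {Labelled p x}) ; resp = λ { p x .x refl v → v } }

        Reach-atom : ∀ {k z x} p → Reach k z x → Valuation.V N p z ⇔ Valuation.V M p x
        Reach-atom p (τ , l , e , d , z≈) = mk⇔
          (λ v → fromWitness (τ , short τ l , e , d , Valuation.resp N p _ _ z≈ v))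
          (λ v → let τ′ , l′ , e′ , d′ , v′ = toWitness {a? = em {Labelled p _}} v
                     z≈′ = ≈-trans (pt-cong τ′ τ d′ d (to (meet⇔ τ′ τ l′ (short τ l)) (_ , e′ , e))) (≈-sym z≈)
                 in Valuation.resp N p _ _ z≈′ v′)

        Reach-forth : ∀ {k z x z′} → Reach (suc k) z x → Rel z z′ → Σ W λ x′ → R x x′ × Reach k z′ x′
        Reach-forth (τ , l , e , d , z≈) r =
          let j , d′ , z′≈ = pt-back τ d (Rel-respˡ z≈ r)
              l′ = shift τ j l
              s , e′ , _ = from (defined⇔ (j ∷ τ) (short (j ∷ τ) l′)) d′
              v , e-v , step-v = walk-∷⁻ j τ e′
              step-x = subst (λ v → step j v ≡ just s) (just-injective (trans (sym e-v) e)) step-v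
          in s , step-sound step-x , j ∷ τ , l′ , e′ , d′ , z′≈

        Reach-back : ∀ {k z x x′} → Reach (suc k) z x → R x x′ → Σ Carrier λ z′ → Rel z z′ × Reach k z′ x′
        Reach-back (τ , l , e , d , z≈) r =
          let j , step-x = step-complete r
              e′ = walk-∷⁺ j τ e step-x
              l′ = shift τ j l
              d′ = to (defined⇔ (j ∷ τ) (short (j ∷ τ) l′)) (_ , e′ , e′)
          in pt (j ∷ τ) d′ , Rel-respˡ (≈-sym z≈) (pt-Rel τ j d d′) , j ∷ τ , l′ , e′ , d′ , ≈-refl

        bisimulation : GradedBisimulation N M
        bisimulation = record { Z = Reach ; atom = Reach-atom ; forth = Reach-forth ; back = Reach-back }

        start : Reach n y w₀
        start = [] , ≤-refl , refl , d[] , pt-[] d[]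

      presentable⇒approximable : DoubleNegationElimination 0ℓ → ExcludedMiddle a → IsSetoidFrame H →
        (∀ y → Presentation y) → Approximable {F = H} {H = frame G}
      presentable⇒approximable dne em laws present n N y = M , w₀ , bisimulation , start
        where open Approximant dne em laws (present y) n N

      sameLogic-by-embedding : DoubleNegationElimination 0ℓ → ExcludedMiddle a → IsSetoidFrame H →
        ModalEmbedding G H → (∀ y → Presentation y) → SameLogic (frame G) H
      sameLogic-by-embedding dne em laws e present φ = mk⇔
        (approximable⇒Λ⊇ (presentable⇒approximable dne em laws present) φ)
        (approximable⇒Λ⊇ (embedding⇒approximable G H laws e) φ)

module Ultrapower (G : Graph) (I : Set) (D : Ultrafilter I) where
  open Graph G
  open QFrame (ultrapower G I D) using (_≈_; Rel)

  laws : IsSetoidFrame (ultrapower G I D)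
  laws = record
    { isEquivalence = record
      { refl  = upward D _ _ (λ _ _ → refl) (top D)
      ; sym   = upward D _ _ (λ _ → sym)
      ; trans = λ p q → upward D _ _ (λ _ (e , e′) → trans e e′) (inter D _ _ p q)
      }
    ; Rel-respˡ = λ p q → upward D _ _ (λ _ (e , r) → subst (λ v → R v _) e r) (inter D _ _ p q)
    }
  open IsSetoidFrame laws using (≈-refl)

  module _ (em : ExcludedMiddle 0ℓ) {m : ℕ} (br : Branching G m) where
    open Branching br
    open Walks G br

    dne : DoubleNegationElimination 0ℓ
    dne = em⇒dne em

    diagonal-back : ∀ {x t} → Rel (λ _ → x) t → Σ W λ s → R x s × t ≈ (λ _ → s)
    diagonal-back {x} {t} r =
      let j , mj = prime-Fin D dne (λ j i → step j x ≡ just (t i)) (upward D _ _ (λ i → step-complete) r)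
          i , e = witness D dne mj
      in t i , step-sound e , upward D _ _ (λ i′ e′ → just-injective (trans (sym e′) e)) mj

    diagonal : ModalEmbedding G (ultrapower G I D)
    diagonal = record
      { embed      = λ x _ → x
      ; embed-Rel  = λ r → upward D _ _ (λ _ _ → r) (top D)
      ; embed-back = diagonal-back
      ; lift-val   = λ M → record
        { V    = λ p g → mem D (λ i → Valuation.V M p (g i))
        ; resp = λ p g g′ g≈g′ v → upward D _ _ (λ i (e , v) → subst (Valuation.V M p) e v) (inter D _ _ g≈g′ v)
        }
      ; lift-embed = λ M p x → mem-const D dne _
      }

    -- g i is a junk default: point g τ i is only ever inspected where walk τ (g i) succeeds.
    point : (I → W) → Word → I → W
    point g τ i = fromMaybe (g i) (walk τ (g i))

    point-walk : ∀ g τ {i s} → walk τ (g i) ≡ just s → point g τ i ≡ s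
    point-walk g τ e rewrite e = refl

    point-back : ∀ g τ {t} → mem D (λ i → Defined τ (g i)) → Rel (point g τ) t →
      Σ (Fin m) λ j → mem D (λ i → walk (j ∷ τ) (g i) ≡ just (t i))
    point-back g τ {t} d r = prime-Fin D dne _ (upward D _ _ extend (inter D _ _ d r))
      where
      extend : ∀ i → Defined τ (g i) × R (point g τ i) (t i) → Σ (Fin m) λ j → walk (j ∷ τ) (g i) ≡ just (t i)
      extend i ((s , e , _) , r) = let j , e′ = step-complete (subst (λ v → R v (t i)) (point-walk g τ e) r)
                                   in j , walk-∷⁺ j τ e e′

    presentation : ∀ g → Presentation (ultrapower G I D) g
    presentation g = record
      { u       = image D g
      ; pt      = λ τ _ → point g τ
      ; pt-[]   = λ _ → ≈-refl
      ; pt-Rel  = λ τ j d d′ → upward D _ _ (λ i (s , e , _) →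
          let v , e-v , step-v = walk-∷⁻ j τ e
          in subst₂ R (sym (point-walk g τ e-v)) (sym (point-walk g (j ∷ τ) e)) (step-sound step-v)) d′
      ; pt-back = λ τ d r → let j , mj = point-back g τ d r in
          j , upward D _ _ (λ i e → _ , e , e) mj , upward D _ _ (λ i e → sym (point-walk g (j ∷ τ) e)) mj
      ; pt-cong = λ τ τ′ _ _ → upward D _ _ (λ i (s , e , e′) → trans (point-walk g τ e) (sym (point-walk g τ′ e′)))
      }

    sameLogic : SameLogic (frame G) (ultrapower G I D)
    sameLogic = sameLogic-by-embedding (ultrapower G I D) dne em laws diagonal presentation

module UltrafilterExtension (G : Graph) where
  open Graph G
  open QFrame (ueFrame G) using (_≈_; Rel)
  module ⇔ {ℓ} = IsEquivalence (⇔-isEquivalence {ℓ})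

  laws : IsSetoidFrame (ueFrame G)
  laws = record
    { isEquivalence = record
      { refl  = λ _ → ⇔.refl
      ; sym   = λ u≈v A → ⇔.sym (u≈v A)
      ; trans = λ u≈v v≈w A → ⇔.trans (u≈v A) (v≈w A)
      }
    ; Rel-respˡ = λ u≈v r X mX → to (u≈v _) (r X mX)
    }
  open IsSetoidFrame laws using (≈-sym)

  module _ (em : ExcludedMiddle (lsuc 0ℓ)) {m : ℕ} (br : Branching G m) where
    open Branching br
    open Walks G br

    em₀ : ExcludedMiddle 0ℓ
    em₀ = lowerExcludedMiddle em

    dne : DoubleNegationElimination 0ℓ
    dne = em⇒dne em₀

    dne₁ : DoubleNegationElimination (lsuc 0ℓ)
    dne₁ = em⇒dne em

    principal : W → Ultrafilter W
    principal x = record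
      { mem = λ A → A x ; top = tt ; proper = λ () ; upward = λ A A′ A⊆A′ → A⊆A′ x
      ; inter = λ A A′ → _,_ ; ultra = λ A → toSum em₀ }

    principal-back : ∀ {x v} → Rel (principal x) v → Σ W λ s → R x s × v ≈ principal s
    principal-back {x} {v} r =
      let steps  = dne λ ∉ → let s , r′ , ¬step = r _ (∉⇒∁∈ v ∉) in ¬step (step-complete r′)
          j , mj = prime-Fin v dne (λ j s → step j x ≡ just s) steps
          s , e  = witness v dne mj
          s∈v    = λ A As → upward v _ _ (λ s′ e′ → subst A (just-injective (trans (sym e) e′)) As) mj
      in s , step-sound e , ≈-sym {principal s} {v} (⊆⇒≈ (principal s) v s∈v)

    principals : ModalEmbedding G (ueFrame G)
    principals = record
      { embed      = principal
      ; embed-Rel  = λ {_} {s} r X Xs → s , r , Xs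
      ; embed-back = λ {x} {t} → principal-back {x} {t}
      ; lift-val   = λ M → record
        { V    = λ p u → Lift (lsuc 0ℓ) (mem u (Valuation.V M p))
        ; resp = λ p u v u≈v m → lift (to (u≈v _) (lower m))
        }
      ; lift-embed = λ M p x → mk⇔ lower lift
      }

    Along : Word → (W → Set) → W → Set
    Along τ A w = Σ W λ s → walk τ w ≡ just s × A s

    module _ (u : Ultrafilter W) where

      image-walk : ∀ τ → mem u (Defined τ) → Ultrafilter W
      image-walk τ d = partialImage u (walk τ) (upward u _ _ (λ w (s , e , _) → s , e) d)

      image-walk-⊆ : ∀ τ τ′ d d′ → mem u (Meet τ τ′) → ∀ A → mem (image-walk τ d) A → mem (image-walk τ′ d′) A
      image-walk-⊆ τ τ′ d d′ q A m = upward u _ _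
        (λ w ((s , e , a) , (_ , e₁ , e₁′)) → s , trans e₁′ (trans (sym e₁) e) , a) (inter u _ _ m q)

      ¬⊆⇒separated : ∀ τ (t : Ultrafilter W) →
        ¬ (∀ A → mem t A → mem u (Along τ A)) → Σ (W → Set) λ A → mem t A × ¬ mem u (Along τ A)
      ¬⊆⇒separated τ t ¬⊆ = dne₁ λ ∄ → ¬⊆ λ A mA → dne λ ∉ → ∄ (A , mA , ∉)

      -- If t refines no image-walk (j ∷ τ), some A_j ∈ t separates it from each; the R-predecessors
      -- of ⋂ A_j ∈ t then lie, u-almost everywhere, along one of the finitely many j ∷ τ.
      image-walk-back : ∀ τ d {t} → Rel (image-walk τ d) t →
        Σ (Fin m) λ j → Σ (mem u (Defined (j ∷ τ))) λ d′ → t ≈ image-walk (j ∷ τ) d′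
      image-walk-back τ d {t} r with em {Σ (Fin m) λ j → ∀ A → mem t A → mem u (Along (j ∷ τ) A)}
      ... | yes (j , t⊆) = j , d′ , ⊆⇒≈ t (image-walk (j ∷ τ) d′) t⊆
        where
        d′ : mem u (Defined (j ∷ τ))
        d′ = upward u _ _ (λ w (s , e , _) → s , e , e) (t⊆ _ (top t))
      ... | no ∄ = let j , mj = prime-Fin u dne _ (upward u _ _ extend (r X X∈t))
                   in ⊥-elim (proj₂ (proj₂ (separate j)) (upward u _ _ (λ w (s , e , Xs) → s , e , Xs j) mj))
        where
        separate : ∀ j → Σ (W → Set) λ A → mem t A × ¬ mem u (Along (j ∷ τ) A)
        separate j = ¬⊆⇒separated (j ∷ τ) t (λ t⊆ → ∄ (j , t⊆))
        X : W → Set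
        X s = ∀ j → proj₁ (separate j) s
        X∈t : mem t X
        X∈t = mem-∀Fin t _ (λ j → proj₁ (proj₂ (separate j)))
        extend : ∀ w → Along τ (λ v → Σ W λ s → R v s × X s) w → Σ (Fin m) λ j → Along (j ∷ τ) X w
        extend w (v , e , s , r , Xs) = let j , e′ = step-complete r in j , s , walk-∷⁺ j τ e e′ , Xs

      presentation : Presentation (ueFrame G) u
      presentation = record
        { u       = u
        ; pt      = image-walk
        ; pt-[]   = λ d → ⊆⇒≈ u (image-walk [] d) (λ A → upward u _ _ (λ w a → w , refl , a))
        ; pt-Rel  = λ τ j d d′ X mX → upward u _ _ (λ w (s , e , Xs) →
            let v , e-v , step-v = walk-∷⁻ j τ e in v , e-v , s , step-sound step-v , Xs) mX
        ; pt-back = image-walk-back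
        ; pt-cong = λ τ τ′ d d′ q → ⊆⇒≈ (image-walk τ d) (image-walk τ′ d′) (image-walk-⊆ τ τ′ d d′ q)
        }

    sameLogic : SameLogic (frame G) (ueFrame G)
    sameLogic = sameLogic-by-embedding (ueFrame G) dne em laws principals presentation

theorem4p5 : ExcludedMiddle (lsuc 0ℓ) →
    (G : Graph) → Bounded G → (I : Set) → (D : Ultrafilter I) →
      SameLogic (frame G) (ueFrame G) × SameLogic (frame G) (ultrapower G I D)
theorem4p5 em G bd I D =
  UltrafilterExtension.sameLogic G em branching ,
  Ultrapower.sameLogic G I D (lowerExcludedMiddle em) branching
  where
  branching : Branching G (proj₁ bd)
  branching = bounded⇒branching G bd
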